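{- Let $A$ be a linear matrix of the form $\begin{bmatrix} C_n\\ F\end{bmatrix}$. If $g=g(A)<n$, then there exists a matrix $F'$ consisting of $h\ge1$ rows of $F$ such that some column submatrix of $\begin{bmatrix} C_n\\ F'\end{bmatrix}$ has an up-matrix congruent to $C_g$.
   Context: A $\{0,1\}$-matrix is linear if it has no $2\times2$ submatrix with all entries 1. For $k\ge 3$, $C_k=(c_{ij})$ is the $k\times k$ matrix with $c_{ij}=1$ iff $j\in\{i,i+1\}$ (indices mod $k$). Matrices are congruent if one arises from the other by permuting rows and columns. $\begin{bmatrix} X\\ Y\end{bmatrix}$ denotes $X$ stacked above $Y$. $g(A)$ is the least odd $k$ such that $A$ has a submatrix congruent to $C_k$ ($\infty$ if none). A row $r$ is dominated if $r\le r'$ componentwise for some other row $r'$; the up-matrix of a matrix is the row submatrix of its non-dominated rows. A column submatrix consists of some of the columns (with all rows). -}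

module Defs where

open import Data.Nat using (ℕ; zero; suc; _+_; _≤_; _<_)
open import Data.Fin using (Fin; toℕ; splitAt)
open import Data.Bool using (Bool; true; false; _∨_; _∧_)
import Data.Bool as B
open import Data.Sum using (_⊎_; [_,_])
open import Data.Product using (Σ; ∃; _×_; _,_)
open import Relation.Binary.PropositionalEquality using (_≡_; _≢_)
open import Relation.Nullary using (¬_)
open import Relation.Nullary.Decidable using (⌊_⌋)
open import Function.Definitions using (Injective)
import Data.Nat as ℕ

Odd : ℕ → Set
Odd k = Σ ℕ λ t → k ≡ suc (t + t)

Matrix : ℕ → ℕ → Set
Matrix m k = Fin m → Fin k → Bool

Linear : ∀ {m k} → Matrix m k → Set
Linear {m} {k} A =
  ¬ (Σ (Fin m) λ i → Σ (Fin m) λ i' → Σ (Fin k) λ j → Σ (Fin k) λ j' →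
       i ≢ i' × j ≢ j' ×
       A i j ≡ true × A i j' ≡ true × A i' j ≡ true × A i' j' ≡ true)

-- C_k : c_ij = 1 iff j ∈ {i, i+1} (indices mod k).
C : (k : ℕ) → Matrix k k
C k i j = ⌊ toℕ j ℕ.≟ toℕ i ⌋ ∨ ⌊ toℕ j ℕ.≟ suc (toℕ i) ⌋
          ∨ (⌊ suc (toℕ i) ℕ.≟ k ⌋ ∧ ⌊ toℕ j ℕ.≟ 0 ⌋)

stack : ∀ {m p k} → Matrix m k → Matrix p k → Matrix (m + p) k
stack {m} X Y r = [ X , Y ] (splitAt m r)

-- A has a submatrix congruent to C_k.  Choosing injective row and column
-- maps (in arbitrary order) accounts for the permutations in congruence.
HasC : ∀ {m k} → Matrix m k → ℕ → Set
HasC {m} {k} A g =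
  Σ (Fin g → Fin m) λ ρ → Σ (Fin g → Fin k) λ σ →
    Injective _≡_ _≡_ ρ × Injective _≡_ _≡_ σ ×
    (∀ i j → A (ρ i) (σ j) ≡ C g i j)

GirthIs : ∀ {m k} → Matrix m k → ℕ → Set
GirthIs A g = Odd g × 3 ≤ g × HasC A g ×
  (∀ k → Odd k → 3 ≤ k → k < g → ¬ HasC A k)

Dominated : ∀ {m k} → Matrix m k → Fin m → Set
Dominated {m} {k} B r = Σ (Fin m) λ r' → r' ≢ r × (∀ j → B r j B.≤ B r' j)

-- The up-matrix of B (rows = non-dominated rows of B) is congruent to C_g:
-- an injective enumeration ρ of exactly the non-dominated rows and a
-- bijective enumeration σ of the columns matching C_g.
UpCongC : ∀ {m k} → Matrix m k → ℕ → Set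
UpCongC {m} {k} B g =
  Σ (Fin g → Fin m) λ ρ → Σ (Fin g → Fin k) λ σ →
    Injective _≡_ _≡_ ρ × Injective _≡_ _≡_ σ ×
    (∀ (j : Fin k) → ∃ λ j' → σ j' ≡ j) ×
    (∀ r → ¬ Dominated B r → ∃ λ i → ρ i ≡ r) ×
    (∀ i → ¬ Dominated B (ρ i)) ×
    (∀ i j → B (ρ i) (σ j) ≡ C g i j)

rowsOf : ∀ {p h k} → Matrix p k → (Fin h → Fin p) → Matrix h k
rowsOf F τ i j = F (τ i) j

colsOf : ∀ {m k q} → Matrix m k → (Fin q → Fin k) → Matrix m q
colsOf A c i j = A i (c j)

module Submission where

-- Take a copy of C_g in A = [C_n; F] with g = g(A) least, and keep exactly the rows of F
-- that it uses.  One is used at all because C_n contains no copy of a shorter C_g: the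
-- columns of such a copy would be closed under the cyclic successor, hence all n of them.
-- On the columns of the copy, no copy row is dominated, since it has two ones and a row
-- above it would complete a 2×2 block of ones.  Every other row is a row of C_n.  Were it
-- to have ones in two of these columns, it would be a chord of the cycle: for adjacent
-- columns this contradicts linearity, and otherwise the chord together with the arc of
-- even length closes an odd cycle shorter than g.  So it has at most one one there and lies
-- below a copy row, and the up-matrix is exactly the copy.

open import Defs
open import Data.Bool using (Bool; true; false; _∨_; _∧_)
import Data.Bool as Bool
open import Data.Bool.Properties using (≤-minimum)
open import Data.Empty using (⊥; ⊥-elim)
open import Data.Fin using (Fin; zero; suc; toℕ; fromℕ<; inject≤; splitAt; join; _↑ˡ_; _↑ʳ_)
import Data.Fin as Fin
open import Data.Fin.Properties using (toℕ-injective; toℕ-fromℕ<; toℕ<n; toℕ-inject≤; injective⇒≤; any?; nonZeroIndex;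
  splitAt-join; join-splitAt; splitAt-↑ˡ; splitAt-↑ʳ; splitAt⁻¹-↑ˡ; splitAt⁻¹-↑ʳ)
  renaming (suc-injective to Fin-suc-injective)
open import Data.Sum.Properties using (inj₁-injective; inj₂-injective)
open import Data.Nat using (ℕ; zero; suc; _+_; _∸_; _≤_; _<_; s≤s; z≤n)
import Data.Nat as ℕ
open import Data.Nat.DivMod using (_%_; m%n<n; m<n⇒m%n≡m; n%n≡0; %-distribˡ-+; m%n%n≡m%n; [m+n]%n≡m%n)
open import Data.Nat.Properties
open import Data.Product using (Σ; ∃; _×_; _,_; proj₁; proj₂)
open import Function using (_∘_; id)
open import Data.Sum using (_⊎_; inj₁; inj₂)
import Data.Sum
open import Function.Definitions using (Injective)
open import Relation.Binary.PropositionalEquality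
open import Relation.Nullary using (¬_; Dec; yes; no)
open import Relation.Binary.Definitions using (tri<; tri≈; tri>)
open import Relation.Nullary.Decidable using (⌊_⌋)

∨-trueˡ : ∀ {x} y → x ≡ true → x ∨ y ≡ true
∨-trueˡ _ refl = refl

∨-trueʳ : ∀ x {y} → y ≡ true → x ∨ y ≡ true
∨-trueʳ true  _ = refl
∨-trueʳ false p = p

⌊⌋-true : ∀ {A : Set} (a? : Dec A) → A → ⌊ a? ⌋ ≡ true
⌊⌋-true (yes _) _ = refl
⌊⌋-true (no ¬a) a = ⊥-elim (¬a a)

≤-from-true : ∀ {x y} → (x ≡ true → y ≡ true) → x Bool.≤ y
≤-from-true {false} _ = ≤-minimum _
≤-from-true {true}  f rewrite f refl = Bool.b≤b

true-≤ : ∀ {x y} → x ≡ true → x Bool.≤ y → y ≡ true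
true-≤ refl Bool.b≤b = refl

≡-from-true⇔ : ∀ {x y : Bool} → (x ≡ true → y ≡ true) → (y ≡ true → x ≡ true) → x ≡ y
≡-from-true⇔ {true}  {true}  _ _ = refl
≡-from-true⇔ {true}  {false} f _ = sym (f refl)
≡-from-true⇔ {false} {true}  _ g = g refl
≡-from-true⇔ {false} {false} _ _ = refl

at-most-two : ∀ {A : Set} {u v a b c : A} → a ≢ b →
  a ≡ u ⊎ a ≡ v → b ≡ u ⊎ b ≡ v → c ≡ u ⊎ c ≡ v → c ≡ a ⊎ c ≡ b
at-most-two a≢b (inj₁ a≡u) (inj₁ b≡u) _ = ⊥-elim (a≢b (trans a≡u (sym b≡u)))
at-most-two a≢b (inj₂ a≡v) (inj₂ b≡v) _ = ⊥-elim (a≢b (trans a≡v (sym b≡v)))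
at-most-two _ (inj₁ a≡u) (inj₂ _) (inj₁ c≡u) = inj₁ (trans c≡u (sym a≡u))
at-most-two _ (inj₁ _) (inj₂ b≡v) (inj₂ c≡v) = inj₂ (trans c≡v (sym b≡v))
at-most-two _ (inj₂ _) (inj₁ b≡u) (inj₁ c≡u) = inj₂ (trans c≡u (sym b≡u))
at-most-two _ (inj₂ a≡v) (inj₁ _) (inj₂ c≡v) = inj₁ (trans c≡v (sym a≡v))

even-or-odd : ∀ n → (∃ λ s → n ≡ s + s) ⊎ (∃ λ s → n ≡ suc (s + s))
even-or-odd zero = inj₁ (0 , refl)
even-or-odd (suc n) with even-or-odd n
... | inj₁ (s , n≡s+s)   = inj₂ (s , cong suc n≡s+s)
... | inj₂ (s , n≡1+s+s) = inj₁ (suc s , cong suc (trans n≡1+s+s (sym (+-suc s s))))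

double-∸ : ∀ t s → (t + t) ∸ (s + s) ≡ (t ∸ s) + (t ∸ s)
double-∸ t       zero    = refl
double-∸ zero    (suc s) = refl
double-∸ (suc t) (suc s) rewrite +-suc t t | +-suc s s = double-∸ t s

odd-complement : ∀ s t d → suc (s + s) + d ≡ suc (t + t) → d ≡ (t ∸ s) + (t ∸ s)
odd-complement s t d eq = begin
  d                     ≡⟨ m+n∸m≡n (s + s) d ⟨
  (s + s + d) ∸ (s + s) ≡⟨ cong (_∸ (s + s)) (suc-injective eq) ⟩
  (t + t) ∸ (s + s)     ≡⟨ double-∸ t s ⟩
  (t ∸ s) + (t ∸ s)     ∎
  where open ≡-Reasoning

half-positive : ∀ s → 1 ≤ s + s → 1 ≤ s
half-positive (suc s) _ = s≤s z≤n

next : ∀ {k} → Fin (suc k) → Fin (suc k)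
next {k} i = fromℕ< (m%n<n (suc (toℕ i)) (suc k))

toℕ-next : ∀ {k} (i : Fin (suc k)) → toℕ (next i) ≡ suc (toℕ i) % suc k
toℕ-next {k} i = toℕ-fromℕ< (m%n<n (suc (toℕ i)) (suc k))

toℕ-next-< : ∀ {k} (i : Fin (suc k)) → suc (toℕ i) < suc k → toℕ (next i) ≡ suc (toℕ i)
toℕ-next-< i lt = trans (toℕ-next i) (m<n⇒m%n≡m lt)

toℕ-next-last : ∀ {k} (i : Fin (suc k)) → suc (toℕ i) ≡ suc k → toℕ (next i) ≡ 0
toℕ-next-last {k} i eq = trans (toℕ-next i) (trans (cong (_% suc k) eq) (n%n≡0 (suc k)))

data NextView {k} (i : Fin (suc k)) : Set where
  within : suc (toℕ i) < suc k → toℕ (next i) ≡ suc (toℕ i) → NextView i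
  wraps  : suc (toℕ i) ≡ suc k → toℕ (next i) ≡ 0 → NextView i

next-view : ∀ {k} (i : Fin (suc k)) → NextView i
next-view i with m≤n⇒m<n∨m≡n (toℕ<n i)
... | inj₁ lt = within lt (toℕ-next-< i lt)
... | inj₂ eq = wraps eq (toℕ-next-last i eq)

next-injective : ∀ {k} → Injective _≡_ _≡_ (next {k})
next-injective {k} {i} {j} eq = toℕ-injective (suc-injective (cases (next-view i) (next-view j)))
  where
  eqℕ : toℕ (next i) ≡ toℕ (next j)
  eqℕ = cong toℕ eq
  cases : NextView i → NextView j → suc (toℕ i) ≡ suc (toℕ j)
  cases (within _ ni) (within _ nj) = trans (sym ni) (trans eqℕ nj)
  cases (within _ ni) (wraps _ nj) with () ← trans (sym ni) (trans eqℕ nj)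
  cases (wraps _ ni) (within _ nj) with () ← trans (sym nj) (trans (sym eqℕ) ni)
  cases (wraps li _) (wraps lj _) = trans li (sym lj)

next-irreflexive : ∀ {k} → 1 ≤ k → (i : Fin (suc k)) → next i ≢ i
next-irreflexive {k} 1≤k i eq = cases (next-view i)
  where
  cases : NextView i → ⊥
  cases (within _ ni) = 1+n≢n (trans (sym ni) (cong toℕ eq))
  cases (wraps li ni) = <⇒≢ (s≤s 1≤k) (trans (sym (cong suc (trans (cong toℕ (sym eq)) ni))) li)

C-diag : ∀ {k} (i : Fin (suc k)) → C (suc k) i i ≡ true
C-diag i = ∨-trueˡ _ (⌊⌋-true (toℕ i ℕ.≟ toℕ i) refl)

C-next : ∀ {k} (i : Fin (suc k)) → C (suc k) i (next i) ≡ true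
C-next {k} i = cases (next-view i)
  where
  j : ℕ
  j = toℕ (next i)
  cases : NextView i → C (suc k) i (next i) ≡ true
  cases (within _ ni) = ∨-trueʳ ⌊ j ℕ.≟ toℕ i ⌋ (∨-trueˡ _ (⌊⌋-true (j ℕ.≟ _) ni))
  cases (wraps li ni) = ∨-trueʳ ⌊ j ℕ.≟ toℕ i ⌋ (∨-trueʳ ⌊ j ℕ.≟ suc (toℕ i) ⌋
    (cong₂ _∧_ (⌊⌋-true (_ ℕ.≟ _) li) (⌊⌋-true (j ℕ.≟ 0) ni)))

C-true⇐ : ∀ {k} (i j : Fin (suc k)) → j ≡ i ⊎ j ≡ next i → C (suc k) i j ≡ true
C-true⇐ i j (inj₁ refl) = C-diag i
C-true⇐ i j (inj₂ refl) = C-next i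

C-true⇒ : ∀ {k} (i j : Fin (suc k)) → C (suc k) i j ≡ true → j ≡ i ⊎ j ≡ next i
C-true⇒ {k} i j h
  with toℕ j ℕ.≟ toℕ i | toℕ j ℕ.≟ suc (toℕ i) | suc (toℕ i) ℕ.≟ suc k | toℕ j ℕ.≟ 0
... | yes e | _     | _     | _      = inj₁ (toℕ-injective e)
... | no _  | yes e | _     | _      = inj₂ (toℕ-injective (trans e (sym (toℕ-next-< i (subst (_< suc k) e (toℕ<n j))))))
... | no _  | no _  | yes e | yes e′ = inj₂ (toℕ-injective (trans e′ (sym (toℕ-next-last i e))))

C-next-invariant : ∀ {k} (i j : Fin (suc k)) → C (suc k) (next i) (next j) ≡ C (suc k) i j
C-next-invariant i j = ≡-from-true⇔ forth back
  where
  forth : C _ (next i) (next j) ≡ true → C _ i j ≡ true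
  forth h with C-true⇒ (next i) (next j) h
  ... | inj₁ e = C-true⇐ i j (inj₁ (next-injective e))
  ... | inj₂ e = C-true⇐ i j (inj₂ (next-injective e))
  back : C _ i j ≡ true → C _ (next i) (next j) ≡ true
  back h with C-true⇒ i j h
  ... | inj₁ e = C-true⇐ (next i) (next j) (inj₁ (cong next e))
  ... | inj₂ e = C-true⇐ (next i) (next j) (inj₂ (cong next e))

rotate : ∀ {k} → ℕ → Fin (suc k) → Fin (suc k)
rotate zero    i = i
rotate (suc c) i = next (rotate c i)

toℕ-rotate : ∀ {k} c (i : Fin (suc k)) → toℕ (rotate c i) ≡ (toℕ i + c) % suc k
toℕ-rotate {k} zero i = sym (trans (cong (_% suc k) (+-identityʳ (toℕ i))) (m<n⇒m%n≡m (toℕ<n i)))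
toℕ-rotate {k} (suc c) i = begin
  toℕ (next (rotate c i))          ≡⟨ toℕ-next (rotate c i) ⟩
  suc (toℕ (rotate c i)) % K       ≡⟨ cong (λ m → suc m % K) (toℕ-rotate c i) ⟩
  (1 + (toℕ i + c) % K) % K        ≡⟨ %-distribˡ-+ 1 ((toℕ i + c) % K) K ⟩
  (1 % K + (toℕ i + c) % K % K) % K ≡⟨ cong (λ m → (1 % K + m) % K) (m%n%n≡m%n (toℕ i + c) K) ⟩
  (1 % K + (toℕ i + c) % K) % K    ≡⟨ sym (%-distribˡ-+ 1 (toℕ i + c) K) ⟩
  suc (toℕ i + c) % K              ≡⟨ cong (_% K) (sym (+-suc (toℕ i) c)) ⟩
  (toℕ i + suc c) % K              ∎
  where
  open ≡-Reasoning
  K : ℕ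
  K = suc k

rotate-injective : ∀ {k} c → Injective _≡_ _≡_ (rotate {k} c)
rotate-injective zero    eq = eq
rotate-injective (suc c) eq = rotate-injective c (next-injective eq)

C-rotate : ∀ {k} c (i j : Fin (suc k)) → C (suc k) (rotate c i) (rotate c j) ≡ C (suc k) i j
C-rotate zero    i j = refl
C-rotate (suc c) i j = trans (C-next-invariant (rotate c i) (rotate c j)) (C-rotate c i j)

rotate-comm : ∀ {k} (i j : Fin (suc k)) → rotate (toℕ i) j ≡ rotate (toℕ j) i
rotate-comm {k} i j = toℕ-injective (begin
  toℕ (rotate (toℕ i) j) ≡⟨ toℕ-rotate (toℕ i) j ⟩
  (toℕ j + toℕ i) % suc k ≡⟨ cong (_% suc k) (+-comm (toℕ j) (toℕ i)) ⟩
  (toℕ i + toℕ j) % suc k ≡⟨ toℕ-rotate (toℕ j) i ⟨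
  toℕ (rotate (toℕ j) i) ∎)
  where open ≡-Reasoning

rotate-full : ∀ {k} (i : Fin (suc k)) → rotate (suc k) i ≡ i
rotate-full {k} i = toℕ-injective (trans (toℕ-rotate (suc k) i) (trans ([m+n]%n≡m%n (toℕ i) (suc k)) (m<n⇒m%n≡m (toℕ<n i))))

C-predecessor : ∀ {k} (j : Fin (suc k)) → C (suc k) (rotate k j) j ≡ true
C-predecessor {k} j = subst (λ c → C (suc k) (rotate k j) c ≡ true) (rotate-full j) (C-next (rotate k j))

Arcs : ∀ {k} → Fin (suc k) → Fin (suc k) → Set
Arcs {k} a b = Σ ℕ λ d → Σ ℕ λ d′ → 1 ≤ d × 1 ≤ d′ × d + d′ ≡ suc k × rotate d a ≡ b × rotate d′ b ≡ a

arcs : ∀ {k} (a b : Fin (suc k)) → toℕ a < toℕ b → Arcs a b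
arcs {k} a b a<b = d , g ∸ d , m<n⇒0<n∸m a<b , m<n⇒0<n∸m d<g , m+[n∸m]≡n (<⇒≤ d<g) , forward , backward
  where
  open ≡-Reasoning
  g u v d : ℕ
  g = suc k
  u = toℕ a
  v = toℕ b
  d = v ∸ u
  d<g : d < g
  d<g = ≤-<-trans (m∸n≤m v u) (toℕ<n b)
  forward : rotate d a ≡ b
  forward = toℕ-injective (begin
    toℕ (rotate d a) ≡⟨ toℕ-rotate d a ⟩
    (u + d) % g      ≡⟨ cong (_% g) (m+[n∸m]≡n (<⇒≤ a<b)) ⟩
    v % g            ≡⟨ m<n⇒m%n≡m (toℕ<n b) ⟩
    v                ∎)
  backward : rotate (g ∸ d) b ≡ a
  backward = toℕ-injective (begin
    toℕ (rotate (g ∸ d) b) ≡⟨ toℕ-rotate (g ∸ d) b ⟩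
    (v + (g ∸ d)) % g       ≡⟨ cong (λ w → (w + (g ∸ d)) % g) (sym (m∸n+n≡m (<⇒≤ a<b))) ⟩
    (d + u + (g ∸ d)) % g   ≡⟨ cong (λ w → (w + (g ∸ d)) % g) (+-comm d u) ⟩
    (u + d + (g ∸ d)) % g   ≡⟨ cong (_% g) (+-assoc u d (g ∸ d)) ⟩
    (u + (d + (g ∸ d))) % g ≡⟨ cong (λ w → (u + w) % g) (m+[n∸m]≡n (<⇒≤ d<g)) ⟩
    (u + g) % g             ≡⟨ [m+n]%n≡m%n u g ⟩
    u % g                   ≡⟨ m<n⇒m%n≡m (toℕ<n a) ⟩
    u                       ∎)

rotate-reaches : ∀ {k} (w z : Fin (suc k)) → ∃ λ c → rotate c w ≡ z
rotate-reaches w z with <-cmp (toℕ w) (toℕ z)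
... | tri< w<z _ _ = let (d , _ , _ , _ , _ , w→z , _) = arcs w z w<z in d , w→z
... | tri≈ _ w≡z _ = 0 , toℕ-injective w≡z
... | tri> _ _ z<w = let (_ , d′ , _ , _ , _ , _ , w→z) = arcs z w z<w in d′ , w→z

C-resize : ∀ {K K′} (i j : Fin K) (i′ j′ : Fin K′) → toℕ i ≡ toℕ i′ → toℕ j ≡ toℕ j′ →
           suc (toℕ i) ≢ K → suc (toℕ i) ≢ K′ → C K i j ≡ C K′ i′ j′
C-resize {K} {K′} i j i′ j′ ei ej i≢K i≢K′ with suc (toℕ i) ℕ.≟ K | suc (toℕ i′) ℕ.≟ K′
... | yes e | _     = ⊥-elim (i≢K e)
... | no _  | yes e = ⊥-elim (i≢K′ (trans (cong suc ei) e))
... | no _  | no _  = cong₂ (λ u v → ⌊ v ℕ.≟ u ⌋ ∨ ⌊ v ℕ.≟ suc u ⌋ ∨ false) ei ej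

Copy : ∀ {m k} → Matrix m k → (g : ℕ) → (Fin g → Fin m) → (Fin g → Fin k) → Set
Copy M g ρ σ = Injective _≡_ _≡_ ρ × Injective _≡_ _≡_ σ × (∀ i j → M (ρ i) (σ j) ≡ C g i j)

Chord : ∀ {m k g} → Matrix m k → (Fin g → Fin k) → Fin m → Fin g → Fin g → Set
Chord M σ x a b = M x (σ a) ≡ true × M x (σ b) ≡ true × (∀ s → M x (σ s) ≡ true → s ≡ a ⊎ s ≡ b)

ShorterOddCycle : ∀ {m k} → Matrix m k → ℕ → Set
ShorterOddCycle M g = Σ ℕ λ K → Odd K × 3 ≤ K × K < g × HasC M K

Chord-swap : ∀ {m k g} {M : Matrix m k} {σ : Fin g → Fin k} {x a b} → Chord M σ x a b → Chord M σ x b a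
Chord-swap (x_a , x_b , only) = x_b , x_a , λ s h → Data.Sum.swap (only s h)

copy-rotate : ∀ {m k g′} {M : Matrix m k} {ρ σ} → Copy M (suc g′) ρ σ → ∀ c →
  Copy M (suc g′) (λ i → ρ (rotate c i)) (λ j → σ (rotate c j))
copy-rotate (ρ-inj , σ-inj , entries) c =
  rotate-injective c ∘ ρ-inj , rotate-injective c ∘ σ-inj , λ i j → trans (entries _ _) (C-rotate c i j)

-- Rows ρ 0, …, ρ (e - 1) and x, on the columns σ 0, …, σ e.
cycle-from-chord-at-zero : ∀ {m k g′} {M : Matrix m k} {ρ σ} → Copy M (suc g′) ρ σ →
  ∀ {x} → (∀ i → ρ i ≢ x) → ∀ e {b} → toℕ b ≡ e → suc e < suc g′ → Chord M σ x zero b → HasC M (suc e)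
cycle-from-chord-at-zero {m} {k} {g′} {M} {ρ} {σ} (ρ-inj , σ-inj , entries) {x} x∉ρ e {b} b≡e e<g
  (x₀ , x_b , only) = row , col , row-inj , col-inj , λ i j → row-entries i j (toℕ i ℕ.<? e)
  where
  e≤g : suc e ≤ suc g′
  e≤g = <⇒≤ e<g

  e<g′ : e < suc g′
  e<g′ = <-trans (n<1+n e) e<g

  last : (i : Fin (suc e)) → ¬ toℕ i < e → toℕ i ≡ e
  last i i≮e = ≤-antisym (ℕ.s≤s⁻¹ (toℕ<n i)) (≮⇒≥ i≮e)

  row′ : (i : Fin (suc e)) → Dec (toℕ i < e) → Fin m
  row′ i (yes i<e) = ρ (fromℕ< (<-trans i<e e<g′))
  row′ i (no _)    = x

  row : Fin (suc e) → Fin m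
  row i = row′ i (toℕ i ℕ.<? e)

  col : Fin (suc e) → Fin k
  col j = σ (inject≤ j e≤g)

  row′-inj : ∀ i i′ d d′ → row′ i d ≡ row′ i′ d′ → i ≡ i′
  row′-inj i i′ (yes _) (yes _) eq =
    toℕ-injective (trans (sym (toℕ-fromℕ< _)) (trans (cong toℕ (ρ-inj eq)) (toℕ-fromℕ< _)))
  row′-inj i i′ (yes _) (no _)  eq = ⊥-elim (x∉ρ _ eq)
  row′-inj i i′ (no _)  (yes _) eq = ⊥-elim (x∉ρ _ (sym eq))
  row′-inj i i′ (no i≮e) (no i′≮e) _ = toℕ-injective (trans (last i i≮e) (sym (last i′ i′≮e)))

  row-inj : Injective _≡_ _≡_ row
  row-inj {i} {i′} = row′-inj i i′ (toℕ i ℕ.<? e) (toℕ i′ ℕ.<? e)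

  col-inj : Injective _≡_ _≡_ col
  col-inj {j} {j′} eq =
    toℕ-injective (trans (sym (toℕ-inject≤ j e≤g)) (trans (cong toℕ (σ-inj eq)) (toℕ-inject≤ j′ e≤g)))

  toℕ-col : ∀ {j c} → inject≤ j e≤g ≡ c → toℕ j ≡ toℕ c
  toℕ-col {j} refl = sym (toℕ-inject≤ j e≤g)

  x-at : ∀ {j c} → toℕ j ≡ toℕ c → M x (σ c) ≡ true → M x (col j) ≡ true
  x-at {j} {c} eq = subst (λ c′ → M x (σ c′) ≡ true) (toℕ-injective (trans (sym eq) (sym (toℕ-inject≤ j e≤g))))

  row-entries : ∀ i j d → M (row′ i d) (col j) ≡ C (suc e) i j
  row-entries i j (yes i<e) = trans (entries _ _) (sym (C-resize i j _ _ (sym (toℕ-fromℕ< _)) (sym (toℕ-inject≤ j e≤g))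
    (<⇒≢ (s≤s i<e)) (<⇒≢ (≤-<-trans i<e e<g′))))
  row-entries i j (no i≮e) = ≡-from-true⇔ forth back
    where
    next-i≡0 : toℕ (next i) ≡ 0
    next-i≡0 = toℕ-next-last i (cong suc (last i i≮e))
    forth : M x (col j) ≡ true → C (suc e) i j ≡ true
    forth h with only _ h
    ... | inj₁ j≡0 = C-true⇐ i j (inj₂ (toℕ-injective (trans (toℕ-col j≡0) (sym next-i≡0))))
    ... | inj₂ j≡b = C-true⇐ i j (inj₁ (toℕ-injective (trans (toℕ-col j≡b) (trans b≡e (sym (last i i≮e))))))
    back : C (suc e) i j ≡ true → M x (col j) ≡ true
    back h with C-true⇒ i j h
    ... | inj₁ refl = x-at (trans (last i i≮e) (sym b≡e)) x_b
    ... | inj₂ refl = x-at next-i≡0 x₀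

module _ {m k} (M : Matrix m k) (linear : Linear M) {t} (1≤t : 1 ≤ t)
  {ρ σ} (copy : Copy M (suc (t + t)) ρ σ) {x} (x∉ρ : ∀ i → ρ i ≢ x) where

  private
    g : ℕ
    g = suc (t + t)
    σ-inj : Injective _≡_ _≡_ σ
    σ-inj = proj₁ (proj₂ copy)
    entries : ∀ i j → M (ρ i) (σ j) ≡ C g i j
    entries = proj₂ (proj₂ copy)

  adjacent-chord-absurd : ∀ {a b} → next a ≡ b → ¬ Chord M σ x a b
  adjacent-chord-absurd {a} refl (x_a , x_b , _) = linear
    (ρ a , x , σ a , σ (next a) , x∉ρ a , (λ eq → next-irreflexive (≤-trans 1≤t (m≤m+n t t)) a (sym (σ-inj eq))) ,
     trans (entries a a) (C-diag a) , trans (entries a (next a)) (C-next a) , x_a , x_b)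

  close-even-arc : ∀ {a b} s d′ → rotate (s + s) a ≡ b → s + s + d′ ≡ g → 1 ≤ s → 2 ≤ d′ →
    Chord M σ x a b → ShorterOddCycle M g
  close-even-arc {a} {b} s d′ a→b sum 1≤s 2≤d′ (x_a , x_b , only) =
    suc (s + s) , (s , refl) , s≤s (+-mono-≤ 1≤s 1≤s) , K<g ,
    cycle-from-chord-at-zero {M = M} (copy-rotate {M = M} copy (toℕ a)) (λ i → x∉ρ _) (s + s) (toℕ-fromℕ< _) K<g
      (subst (λ c → M x (σ c) ≡ true) (sym start) x_a , subst (λ c → M x (σ c) ≡ true) (sym end) x_b , only′)
    where
    K<g : suc (s + s) < g
    K<g = subst (suc (suc (s + s)) ≤_) sum (subst (_≤ s + s + d′) (+-comm (s + s) 2) (+-monoʳ-≤ (s + s) 2≤d′))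
    b′ : Fin g
    b′ = fromℕ< (<-trans (n<1+n _) K<g)
    start : rotate (toℕ a) zero ≡ a
    start = rotate-comm a zero
    end : rotate (toℕ a) b′ ≡ b
    end = trans (rotate-comm a b′) (trans (cong (λ c → rotate c a) (toℕ-fromℕ< {s + s} _)) a→b)
    only′ : ∀ r → M x (σ (rotate (toℕ a) r)) ≡ true → r ≡ zero ⊎ r ≡ b′
    only′ r h with only _ h
    ... | inj₁ r→a = inj₁ (rotate-injective (toℕ a) (trans r→a (sym start)))
    ... | inj₂ r→b = inj₂ (rotate-injective (toℕ a) (trans r→b (sym end)))

  cycle-from-even-arc : ∀ {a b} s d′ → 1 ≤ s + s → 1 ≤ d′ → s + s + d′ ≡ g →
    rotate (s + s) a ≡ b → rotate d′ b ≡ a →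
    Chord M σ x a b → ShorterOddCycle M g
  cycle-from-even-arc s d′ 1≤d 1≤d′ sum a→b b→a chord with m≤n⇒m<n∨m≡n 1≤d′
  ... | inj₁ 2≤d′ = close-even-arc s d′ a→b sum (half-positive s 1≤d) 2≤d′ chord
  ... | inj₂ refl = ⊥-elim (adjacent-chord-absurd b→a (Chord-swap {M = M} {σ = σ} chord))

  -- One of the two arcs has even length, since their lengths add up to the odd g.
  cycle-from-arcs : ∀ {a b} → Arcs a b → Chord M σ x a b → ShorterOddCycle M g
  cycle-from-arcs (d , d′ , 1≤d , 1≤d′ , sum , a→b , b→a) chord with even-or-odd d
  ... | inj₁ (s , refl) = cycle-from-even-arc s d′ 1≤d 1≤d′ sum a→b b→a chord
  ... | inj₂ (s , refl) = cycle-from-even-arc (t ∸ s) d (subst (1 ≤_) d′-even 1≤d′) 1≤d sum′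
          (subst (λ e → rotate e _ ≡ _) d′-even b→a) a→b (Chord-swap {M = M} {σ = σ} chord)
    where
    d′-even : d′ ≡ (t ∸ s) + (t ∸ s)
    d′-even = odd-complement s t d′ sum
    sum′ : (t ∸ s) + (t ∸ s) + suc (s + s) ≡ g
    sum′ = trans (cong (_+ suc (s + s)) (sym d′-even)) (trans (+-comm d′ (suc (s + s))) sum)

  shorter-odd-cycle : ∀ {a b} → a ≢ b → Chord M σ x a b → ShorterOddCycle M g
  shorter-odd-cycle {a} {b} a≢b chord with <-cmp (toℕ a) (toℕ b)
  ... | tri< a<b _ _ = cycle-from-arcs (arcs a b a<b) chord
  ... | tri≈ _ a≡b _ = ⊥-elim (a≢b (toℕ-injective a≡b))
  ... | tri> _ _ b<a = cycle-from-arcs (arcs b a b<a) (Chord-swap {M = M} {σ = σ} chord)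

module _ {n′ g′} (1≤g′ : 1 ≤ g′) {φ σ} (copy : Copy (C (suc n′)) (suc g′) φ σ) where

  private
    φ-inj : Injective _≡_ _≡_ φ
    φ-inj = proj₁ copy
    σ-inj : Injective _≡_ _≡_ σ
    σ-inj = proj₁ (proj₂ copy)
    entries : ∀ i j → C (suc n′) (φ i) (σ j) ≡ C (suc g′) i j
    entries = proj₂ (proj₂ copy)
    on-row : ∀ {i j} → C (suc g′) i j ≡ true → σ j ≡ φ i ⊎ σ j ≡ next (φ i)
    on-row {i} {j} h = C-true⇒ (φ i) (σ j) (trans (entries i j) h)

  -- Column j of C (suc g′) has ones in rows j and rotate g′ j (its predecessor); their images are two
  -- distinct rows of C (suc n′) meeting column σ j, and only the rows σ j and its predecessor do.
  column-is-row : ∀ j → ∃ λ i → φ i ≡ σ j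
  column-is-row j with on-row (C-diag j) | on-row (C-predecessor j)
  ... | inj₁ σj≡φj | _ = j , sym σj≡φj
  ... | inj₂ _ | inj₁ σj≡φr = rotate g′ j , sym σj≡φr
  ... | inj₂ σj≡φj⁺ | inj₂ σj≡φr⁺ =
    ⊥-elim (next-irreflexive 1≤g′ _ (trans (rotate-full j) (φ-inj (next-injective (trans (sym σj≡φj⁺) σj≡φr⁺)))))

  row-successor-is-column : ∀ i → ∃ λ j → σ j ≡ next (φ i)
  row-successor-is-column i with on-row (C-diag i) | on-row (C-next i)
  ... | inj₂ σi≡φi⁺ | _ = i , σi≡φi⁺
  ... | inj₁ _ | inj₂ σi⁺≡φi⁺ = next i , σi⁺≡φi⁺
  ... | inj₁ σi≡φi | inj₁ σi⁺≡φi = ⊥-elim (next-irreflexive 1≤g′ i (σ-inj (trans σi⁺≡φi (sym σi≡φi))))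

  columns-rotate : ∀ c → ∃ λ j → σ j ≡ rotate c (σ zero)
  columns-rotate zero = zero , refl
  columns-rotate (suc c) with columns-rotate c
  ... | j , σj≡ with column-is-row j
  ...   | i , φi≡σj with row-successor-is-column i
  ...     | j′ , σj′≡ = j′ , trans σj′≡ (cong next (trans φi≡σj σj≡))

  columns-surjective : ∀ y → ∃ λ j → σ j ≡ y
  columns-surjective y with rotate-reaches (σ zero) y
  ... | c , reaches with columns-rotate c
  ...   | j , σj≡ = j , trans σj≡ reaches

  copy-in-C⇒≤ : suc n′ ≤ suc g′
  copy-in-C⇒≤ = injective⇒≤ {f = λ y → proj₁ (columns-surjective y)} λ {y} {y′} eq →
    trans (sym (proj₂ (columns-surjective y))) (trans (cong σ eq) (proj₂ (columns-surjective y′)))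

copy-row-undominated : ∀ {m k g′} (M : Matrix m k) → Linear M → 1 ≤ g′ → ∀ {ρ σ} → Copy M (suc g′) ρ σ →
  ∀ i → ¬ Dominated (colsOf M σ) (ρ i)
copy-row-undominated M linear 1≤g′ {ρ} {σ} (_ , σ-inj , entries) i (r , r≢ρi , ≤r) = linear
  (ρ i , r , σ i , σ (next i) , (λ eq → r≢ρi (sym eq)) , (λ eq → next-irreflexive 1≤g′ i (sym (σ-inj eq))) ,
   ρi-i , ρi-i⁺ , true-≤ ρi-i (≤r i) , true-≤ ρi-i⁺ (≤r (next i)))
  where
  ρi-i : M (ρ i) (σ i) ≡ true
  ρi-i = trans (entries i i) (C-diag i)
  ρi-i⁺ : M (ρ i) (σ (next i)) ≡ true
  ρi-i⁺ = trans (entries i (next i)) (C-next i)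

sparse-row-dominated : ∀ {m k g′} (M : Matrix m k) {ρ σ} → Copy M (suc g′) ρ σ → ∀ {r} → (∀ i → ρ i ≢ r) →
  (∀ j j′ → M r (σ j) ≡ true → M r (σ j′) ≡ true → j ≡ j′) → Dominated (colsOf M σ) r
sparse-row-dominated M {ρ} {σ} (_ , _ , entries) {r} r∉ρ at-most-one with any? (λ j → M r (σ j) Bool.≟ true)
... | no none = ρ zero , r∉ρ zero , λ j → ≤-from-true (λ h → ⊥-elim (none (j , h)))
... | yes (j₀ , h₀) = ρ j₀ , r∉ρ j₀ , λ j → ≤-from-true λ h →
  subst (λ c → M (ρ j₀) (σ c) ≡ true) (sym (at-most-one j j₀ h h₀)) (trans (entries j₀ j₀) (C-diag j₀))

record Enumeration {p} (P : Fin p → Set) : Set where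
  field
    size : ℕ
    elem : Fin size → Fin p
    elem-injective : Injective _≡_ _≡_ elem
    elem-sound : ∀ k → P (elem k)
    elem-complete : ∀ y → P y → ∃ λ k → elem k ≡ y

enumerate : ∀ {p} {P : Fin p → Set} → (∀ y → Dec (P y)) → Enumeration P
enumerate {zero} _ = record
  { size = 0 ; elem = λ () ; elem-injective = λ { {()} } ; elem-sound = λ () ; elem-complete = λ () }
enumerate {suc p} {P} P? with enumerate (P? ∘ suc) | P? zero
... | E | no ¬P0 = record
  { size = size ; elem = suc ∘ elem ; elem-injective = elem-injective ∘ Fin-suc-injective ; elem-sound = elem-sound
  ; elem-complete = λ { zero P0 → ⊥-elim (¬P0 P0) ; (suc y) Py → Data.Product.map₂ (cong suc) (elem-complete y Py) } }
  where open Enumeration E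
... | E | yes P0 = record
  { size = suc size ; elem = elem′ ; elem-injective = inj ; elem-sound = sound
  ; elem-complete = λ { zero _ → zero , refl ; (suc y) Py → Data.Product.map suc (cong suc) (elem-complete y Py) } }
  where
  open Enumeration E
  elem′ : Fin (suc size) → Fin (suc p)
  elem′ zero    = zero
  elem′ (suc k) = suc (elem k)
  inj : Injective _≡_ _≡_ elem′
  inj {zero}  {zero}  _  = refl
  inj {suc k} {suc l} eq = cong suc (elem-injective (Fin-suc-injective eq))
  inj {zero}  {suc _} ()
  inj {suc _} {zero}  ()
  sound : ∀ k → P (elem′ k)
  sound zero    = P0
  sound (suc k) = elem-sound k

module _ {m m′ k} (M : Matrix m k) {N : Matrix m′ k} {ι : Fin m′ → Fin m}
  (ι-inj : Injective _≡_ _≡_ ι) (N≡M : ∀ r c → N r c ≡ M (ι r) c) where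

  Linear-reindex : Linear M → Linear N
  Linear-reindex linear (r , r′ , c , c′ , r≢r′ , c≢c′ , e₁ , e₂ , e₃ , e₄) = linear
    (ι r , ι r′ , c , c′ , r≢r′ ∘ ι-inj , c≢c′ ,
     trans (sym (N≡M r c)) e₁ , trans (sym (N≡M r c′)) e₂ , trans (sym (N≡M r′ c)) e₃ , trans (sym (N≡M r′ c′)) e₄)

  HasC-reindex : ∀ {K} → HasC N K → HasC M K
  HasC-reindex (ρ , σ , ρ-inj , σ-inj , entries) =
    ι ∘ ρ , σ , ρ-inj ∘ ι-inj , σ-inj , λ i j → trans (sym (N≡M (ρ i) (σ j))) (entries i j)

  copy-reindex : ∀ {g ρ} {σ : Fin g → Fin k} (ρ′ : Fin g → Fin m′) → (∀ i → ι (ρ′ i) ≡ ρ i) →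
    Copy M g ρ σ → Copy N g ρ′ σ
  copy-reindex {σ = σ} ρ′ ιρ′≡ρ (ρ-inj , σ-inj , entries) =
    (λ {i} {j} eq → ρ-inj (trans (sym (ιρ′≡ρ i)) (trans (cong ι eq) (ιρ′≡ρ j)))) , σ-inj ,
    λ i j → trans (N≡M (ρ′ i) (σ j)) (trans (cong (λ r → M r (σ j)) (ιρ′≡ρ i)) (entries i j))

map₂-injective : ∀ {A B C : Set} {f : B → C} → Injective _≡_ _≡_ f → Injective _≡_ _≡_ (Data.Sum.map₂ {A = A} f)
map₂-injective f-inj {inj₁ _} {inj₁ _} eq = cong inj₁ (inj₁-injective eq)
map₂-injective f-inj {inj₂ _} {inj₂ _} eq = cong inj₂ (f-inj (inj₂-injective eq))
map₂-injective f-inj {inj₁ _} {inj₂ _} ()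
map₂-injective f-inj {inj₂ _} {inj₁ _} ()

splitAt-injective : ∀ n {p} → Injective _≡_ _≡_ (splitAt n {p})
splitAt-injective n {p} {r} {r′} eq = trans (sym (join-splitAt n p r)) (trans (cong (join n p) eq) (join-splitAt n p r′))

liftLower : ∀ n {p h} → (Fin h → Fin p) → Fin (n + h) → Fin (n + p)
liftLower n {p} τ = join n p ∘ Data.Sum.map₂ τ ∘ splitAt n

module _ (n : ℕ) {p h} {τ : Fin h → Fin p} where

  liftLower-injective : Injective _≡_ _≡_ τ → Injective _≡_ _≡_ (liftLower n τ)
  liftLower-injective τ-inj {r} {r′} eq = splitAt-injective n (map₂-injective τ-inj
    (trans (sym (splitAt-join n p _)) (trans (cong (splitAt n) eq) (splitAt-join n p _))))

  liftLower-↑ˡ : ∀ x → liftLower n τ (x ↑ˡ h) ≡ x ↑ˡ p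
  liftLower-↑ˡ x rewrite splitAt-↑ˡ n x h = refl

  liftLower-↑ʳ : ∀ k → liftLower n τ (n ↑ʳ k) ≡ n ↑ʳ τ k
  liftLower-↑ʳ k rewrite splitAt-↑ʳ n h k = refl

  stack-rowsOf : ∀ {k} (X : Matrix n k) (Y : Matrix p k) r c → stack X (rowsOf Y τ) r c ≡ stack X Y (liftLower n τ r) c
  stack-rowsOf X Y r c rewrite splitAt-join n p (Data.Sum.map₂ τ (splitAt n r)) with splitAt n r
  ... | inj₁ _ = refl
  ... | inj₂ _ = refl

  liftLower-preimage : ∀ r → (∀ y → r ≡ n ↑ʳ y → ∃ λ k → τ k ≡ y) → ∃ λ r′ → liftLower n τ r′ ≡ r
  liftLower-preimage r covered with splitAt n r in eq
  ... | inj₁ x = x ↑ˡ h , trans (liftLower-↑ˡ x) (splitAt⁻¹-↑ˡ eq)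
  ... | inj₂ y with covered y (sym (splitAt⁻¹-↑ʳ eq))
  ...   | k , τk≡y = n ↑ʳ k , trans (liftLower-↑ʳ k) (trans (cong (n ↑ʳ_) τk≡y) (splitAt⁻¹-↑ʳ eq))

stack-upper : ∀ {n p k} (X : Matrix n k) (Y : Matrix p k) {r x} → splitAt n r ≡ inj₁ x → ∀ c → stack X Y r c ≡ X x c
stack-upper X Y eq c rewrite eq = refl

lower? : ∀ {A B : Set} (s : A ⊎ B) → Dec (∃ λ b → s ≡ inj₂ b)
lower? (inj₁ _) = no λ { (_ , ()) }
lower? (inj₂ b) = yes (b , refl)

copy-meets-lower-block : ∀ {n′ p g′} (F : Matrix p (suc n′)) → 1 ≤ g′ → suc g′ < suc n′ → ∀ {ρ σ} →
  Copy (stack (C (suc n′)) F) (suc g′) ρ σ → ∃ λ i → ∃ λ y → ρ i ≡ suc n′ ↑ʳ y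
copy-meets-lower-block {n′} {p} {g′} F 1≤g′ g<n {ρ} {σ} (ρ-inj , σ-inj , entries)
  with any? (λ i → lower? (splitAt (suc n′) (ρ i)))
... | yes (i , y , eq) = i , y , sym (splitAt⁻¹-↑ʳ eq)
... | no none = ⊥-elim (<⇒≱ g<n (copy-in-C⇒≤ 1≤g′ copy-in-C))
  where
  upper : ∀ i → ∃ λ x → splitAt (suc n′) (ρ i) ≡ inj₁ x
  upper i with splitAt (suc n′) (ρ i) in eq
  ... | inj₁ x = x , refl
  ... | inj₂ y = ⊥-elim (none (i , y , eq))
  φ : Fin (suc g′) → Fin (suc n′)
  φ i = proj₁ (upper i)
  φ-inj : Injective _≡_ _≡_ φ
  φ-inj {i} {j} eq = ρ-inj (splitAt-injective (suc n′) (trans (proj₂ (upper i)) (trans (cong inj₁ eq) (sym (proj₂ (upper j))))))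
  copy-in-C : Copy (C (suc n′)) (suc g′) φ σ
  copy-in-C = φ-inj , σ-inj , λ i j → trans (sym (stack-upper (C (suc n′)) F {r = ρ i} (proj₂ (upper i)) (σ j))) (entries i j)

module _ {n′ h t} (G : Matrix h (suc n′)) (linear : Linear (stack (C (suc n′)) G)) (1≤t : 1 ≤ t)
  {ρ σ} (copy : Copy (stack (C (suc n′)) G) (suc (t + t)) ρ σ)
  (minimal : ¬ ShorterOddCycle (stack (C (suc n′)) G) (suc (t + t))) where

  private
    M : Matrix (suc n′ + h) (suc n′)
    M = stack (C (suc n′)) G
    σ-inj : Injective _≡_ _≡_ σ
    σ-inj = proj₁ (proj₂ copy)

  -- Two ones of an upper row among the columns σ would form a chord, giving a shorter odd cycle.
  upper-row-sparse : ∀ {r x} → splitAt (suc n′) r ≡ inj₁ x → (∀ i → ρ i ≢ r) →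
    ∀ j j′ → M r (σ j) ≡ true → M r (σ j′) ≡ true → j ≡ j′
  upper-row-sparse {r} {x} eq r∉ρ j j′ hj hj′ with j Fin.≟ j′
  ... | yes j≡j′ = j≡j′
  ... | no j≢j′ = ⊥-elim (minimal (shorter-odd-cycle M linear 1≤t copy r∉ρ j≢j′ (hj , hj′ , only)))
    where
    on-row : ∀ {s} → M r (σ s) ≡ true → σ s ≡ x ⊎ σ s ≡ next x
    on-row {s} h = C-true⇒ x (σ s) (trans (sym (stack-upper (C (suc n′)) G {r = r} eq (σ s))) h)
    only : ∀ s → M r (σ s) ≡ true → s ≡ j ⊎ s ≡ j′
    only s hs = Data.Sum.map σ-inj σ-inj (at-most-two (j≢j′ ∘ σ-inj) (on-row hj) (on-row hj′) (on-row hs))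

  module _ (lower-used : ∀ k → ∃ λ i → ρ i ≡ suc n′ ↑ʳ k) where

    outside-dominated : ∀ r → (∀ i → ρ i ≢ r) → Dominated (colsOf M σ) r
    outside-dominated r r∉ρ = by-block (splitAt (suc n′) r) refl
      where
      by-block : ∀ s → splitAt (suc n′) r ≡ s → Dominated (colsOf M σ) r
      by-block (inj₁ x) eq = sparse-row-dominated M copy r∉ρ (upper-row-sparse eq r∉ρ)
      by-block (inj₂ k) eq = let (i , ρi≡) = lower-used k in ⊥-elim (r∉ρ i (trans ρi≡ (splitAt⁻¹-↑ʳ eq)))

    up-matrix-of-minimal-copy : UpCongC (colsOf M σ) (suc (t + t))
    up-matrix-of-minimal-copy = ρ , id , proj₁ copy , id , (λ j → j , refl) , in-copy ,
      copy-row-undominated M linear (≤-trans 1≤t (m≤m+n t t)) copy , proj₂ (proj₂ copy)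
      where
      in-copy : ∀ r → ¬ Dominated (colsOf M σ) r → ∃ λ i → ρ i ≡ r
      in-copy r ¬dom with any? (λ i → ρ i Fin.≟ r)
      ... | yes r∈ρ = r∈ρ
      ... | no r∉ρ = ⊥-elim (¬dom (outside-dominated r λ i ρi≡r → r∉ρ (i , ρi≡r)))

lemma4 : (n p : ℕ) → 3 ≤ n → (F : Matrix p n) →
    Linear (stack (C n) F) →
    (g : ℕ) → GirthIs (stack (C n) F) g → g < n →
    Σ ℕ λ h → 1 ≤ h × Σ (Fin h → Fin p) λ τ → Injective _≡_ _≡_ τ ×
      Σ ℕ λ q → Σ (Fin q → Fin n) λ c → Injective _≡_ _≡_ c ×
        UpCongC (colsOf (stack (C n) (rowsOf F τ)) c) g
lemma4 (suc n′) p _ F linear g ((t , refl) , 3≤g , (ρ , σ , copy) , shortest) g<n =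
  size , ℕ.>-nonZero⁻¹ size {{nonZeroIndex k₀}} , elem , elem-injective , g , σ , proj₁ (proj₂ copy) ,
  up-matrix-of-minimal-copy (rowsOf F elem) (Linear-reindex A ι-inj N≡A linear) 1≤t copy′ minimal′ lower-used
  where
  n : ℕ
  n = suc n′
  A : Matrix (n + p) n
  A = stack (C n) F
  open Enumeration (enumerate (λ y → any? (λ i → ρ i Fin.≟ n ↑ʳ y)))
  1≤t : 1 ≤ t
  1≤t = half-positive t (<⇒≤ (ℕ.s≤s⁻¹ 3≤g))
  k₀ : Fin size
  k₀ = let (i , y , ρi≡y) = copy-meets-lower-block F (≤-trans 1≤t (m≤m+n t t)) g<n copy in
       proj₁ (elem-complete y (i , ρi≡y))
  ι : Fin (n + size) → Fin (n + p)
  ι = liftLower n elem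
  ι-inj : Injective _≡_ _≡_ ι
  ι-inj = liftLower-injective n elem-injective
  N≡A : ∀ r c → stack (C n) (rowsOf F elem) r c ≡ A (ι r) c
  N≡A = stack-rowsOf n (C n) F
  preimage : ∀ i → ∃ λ r → ι r ≡ ρ i
  preimage i = liftLower-preimage n (ρ i) (λ y ρi≡y → elem-complete y (i , ρi≡y))
  copy′ : Copy (stack (C n) (rowsOf F elem)) g (proj₁ ∘ preimage) σ
  copy′ = copy-reindex A ι-inj N≡A (proj₁ ∘ preimage) (proj₂ ∘ preimage) copy
  minimal′ : ¬ ShorterOddCycle (stack (C n) (rowsOf F elem)) g
  minimal′ (K , odd , 3≤K , K<g , hasC) = shortest K odd 3≤K K<g (HasC-reindex A ι-inj N≡A hasC)
  lower-used : ∀ k → ∃ λ i → proj₁ (preimage i) ≡ n ↑ʳ k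
  lower-used k = let (i , ρi≡) = elem-sound k in
    i , ι-inj (trans (proj₂ (preimage i)) (trans ρi≡ (sym (liftLower-↑ʳ n k))))
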